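{- For every propositional formula $\varphi$ and every three-valued Gödel interpretation $\bm{m}$, $\bm{m}(\neg\varphi)=1$ if and only if $\bm{m}^{c}(\varphi)=0$.
   Context: Fix a nonempty set $\mathtt{VAR}$ of atoms. Formulas are generated by $\varphi,\psi ::= p \mid \bot \mid \varphi\wedge\psi \mid \varphi\vee\psi \mid \varphi\to\psi$ with $p\in\mathtt{VAR}$; $\neg\varphi$ abbreviates $\varphi\to\bot$. A three-valued Gödel ($G_3$) interpretation is a map $\bm{m}:\mathtt{VAR}\to\{0,\tfrac12,1\}$, extended to formulas by $\bm{m}(\bot)=0$, $\bm{m}(\varphi\wedge\psi)=\min\{\bm{m}(\varphi),\bm{m}(\psi)\}$, $\bm{m}(\varphi\vee\psi)=\max\{\bm{m}(\varphi),\bm{m}(\psi)\}$, and $\bm{m}(\varphi\to\psi)=1$ if $\bm{m}(\varphi)\le\bm{m}(\psi)$ and $\bm{m}(\varphi\to\psi)=\bm{m}(\psi)$ otherwise. The crisp interpretation $\bm{m}^{c}$ of $\bm{m}$ is defined by $\bm{m}^{c}(p)=1$ if $\bm{m}(p)=\tfrac12$ and $\bm{m}^{c}(p)=\bm{m}(p)$ otherwise, for all $p\in\mathtt{VAR}$. -}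

module Defs where

open import Data.Bool using (Bool; true; false)

data V3 : Set where
  v0 v½ v1 : V3

_≤ᵇ_ : V3 → V3 → Bool
v0 ≤ᵇ _  = true
v½ ≤ᵇ v0 = false
v½ ≤ᵇ _  = true
v1 ≤ᵇ v1 = true
v1 ≤ᵇ _  = false

min max : V3 → V3 → V3
min x y with x ≤ᵇ y
... | true  = x
... | false = y
max x y with x ≤ᵇ y
... | true  = y
... | false = x

data Form (VAR : Set) : Set where
  atom : VAR → Form VAR
  ⊥′   : Form VAR
  _∧′_ _∨′_ _⇒_ : Form VAR → Form VAR → Form VAR

¬′_ : {VAR : Set} → Form VAR → Form VAR
¬′ φ = φ ⇒ ⊥′

imp : V3 → V3 → V3
imp x y with x ≤ᵇ y
... | true  = v1
... | false = y

eval : {VAR : Set} → (VAR → V3) → Form VAR → V3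
eval m (atom p) = m p
eval m ⊥′       = v0
eval m (φ ∧′ ψ) = min (eval m φ) (eval m ψ)
eval m (φ ∨′ ψ) = max (eval m φ) (eval m ψ)
eval m (φ ⇒ ψ)  = imp (eval m φ) (eval m ψ)

crispV : V3 → V3
crispV v½ = v1
crispV x  = x

crisp : {VAR : Set} → (VAR → V3) → (VAR → V3)
crisp m p = crispV (m p)

{-# OPTIONS --safe #-}
-- Collapsing ½ to 1 is a homomorphism of G3 onto its Boolean subalgebra {0, 1},
-- so m^c(φ) is the crisp image of m(φ); and ¬x = 1 holds exactly when x = 0,
-- which is also exactly when the crisp image of x is 0.
module Submission where

open import Defs
open import Relation.Binary.PropositionalEquality using (_≡_; refl; cong₂; sym; trans)
open import Function.Bundles using (_⇔_; mk⇔)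

crispV-min : ∀ x y → crispV (min x y) ≡ min (crispV x) (crispV y)
crispV-min v0 _  = refl
crispV-min v½ v0 = refl
crispV-min v½ v½ = refl
crispV-min v½ v1 = refl
crispV-min v1 v0 = refl
crispV-min v1 v½ = refl
crispV-min v1 v1 = refl

crispV-max : ∀ x y → crispV (max x y) ≡ max (crispV x) (crispV y)
crispV-max v0 _  = refl
crispV-max v½ v0 = refl
crispV-max v½ v½ = refl
crispV-max v½ v1 = refl
crispV-max v1 v0 = refl
crispV-max v1 v½ = refl
crispV-max v1 v1 = refl

crispV-imp : ∀ x y → crispV (imp x y) ≡ imp (crispV x) (crispV y)
crispV-imp v0 _  = refl
crispV-imp v½ v0 = refl
crispV-imp v½ v½ = refl
crispV-imp v½ v1 = refl
crispV-imp v1 v0 = refl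
crispV-imp v1 v½ = refl
crispV-imp v1 v1 = refl

eval-crisp : {VAR : Set} (m : VAR → V3) (φ : Form VAR) →
             eval (crisp m) φ ≡ crispV (eval m φ)
eval-crisp m (atom p) = refl
eval-crisp m ⊥′       = refl
eval-crisp m (φ ∧′ ψ) =
  trans (cong₂ min (eval-crisp m φ) (eval-crisp m ψ)) (sym (crispV-min (eval m φ) (eval m ψ)))
eval-crisp m (φ ∨′ ψ) =
  trans (cong₂ max (eval-crisp m φ) (eval-crisp m ψ)) (sym (crispV-max (eval m φ) (eval m ψ)))
eval-crisp m (φ ⇒ ψ)  =
  trans (cong₂ imp (eval-crisp m φ) (eval-crisp m ψ)) (sym (crispV-imp (eval m φ) (eval m ψ)))

imp-v0≡v1⇔crispV≡v0 : ∀ x → (imp x v0 ≡ v1) ⇔ (crispV x ≡ v0)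
imp-v0≡v1⇔crispV≡v0 v0 = mk⇔ (λ _ → refl) (λ _ → refl)
imp-v0≡v1⇔crispV≡v0 v½ = mk⇔ (λ ()) (λ ())
imp-v0≡v1⇔crispV≡v0 v1 = mk⇔ (λ ()) (λ ())

corollary1 : (VAR : Set) → VAR → (φ : Form VAR) → (m : VAR → V3) →
    (eval m (¬′ φ) ≡ v1) ⇔ (eval (crisp m) φ ≡ v0)
corollary1 _ _ φ m rewrite eval-crisp m φ = imp-v0≡v1⇔crispV≡v0 (eval m φ)
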